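{- Let $w$ be a permutation. Label each plus of $\mathcal T_w$ by the element $(i,j)\in D(w)$ via the bijection $(i,j)\mapsto(i-r_w(i,j),j)$ from $D(w)$ to $\mathcal T_w$, and label each plus of $\mathcal B_w$ by $(i,j)\in D(w)$ via the bijection $(i,j)\mapsto(i,j-r_w(i,j))$ from $D(w)$ to $\mathcal B_w$. Then this labeling of $\mathcal T_w$ is the same as the labeling that $\mathcal T_w$ inherits from the labeling of $\mathcal B_w$ along any path of simple ladder moves from $\mathcal B_w$ to $\mathcal T_w$.
   Context: For $w\in S_n$, the Rothe diagram is $D(w)=\{(i,j):1\le i,j\le n,\ w(i)>j,\ w^{ -1}(j)>i\}$ and the rank function is $r_w(i,j)=\#\{k:1\le k\le i,\ w(k)\le j\}$. Pipe dreams are tilings of $\mathbb Z_{>0}\times\mathbb Z_{>0}$ (matrix coordinates) by pluses and elbows, identified with the set of positions of pluses. With $m_i(w)=\#\{j>i: w(j)<w(i)\}$, the bottom pipe dream is $\mathcal B_w=\{(i,j): j\le m_i(w)\}$ (obtained from $D(w)$ by left-justifying boxes in each row), and the top pipe dream is $\mathcal T_w=\mathcal B_{w^{ -1}}^t$ (obtained from $D(w)$ by top-justifying boxes in each column). The maps $(i,j)\mapsto(i,j-r_w(i,j))$ and $(i,j)\mapsto(i-r_w(i,j),j)$ are bijections from $D(w)$ onto $\mathcal B_w$ and $\mathcal T_w$ respectively, and $\mathcal B_w$ and $\mathcal T_w$ are connected by a sequence of simple ladder moves. A simple ladder move $\mathcal P\mapsto\mathcal P'$ adds a plus at some $(i,j)$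 and removes the plus at $(i+1,j-1)$, with $(i,j-1)$ and $(i+1,j)$ being elbows. A labeling of a pipe dream $\mathcal P$ is an injective map $\mathcal L_\mathcal P:\mathcal P\to I$; under a simple ladder move, $\mathcal P'$ inherits $\mathcal L_{\mathcal P'}(i,j)=\mathcal L_\mathcal P(i,j)$ if $(i,j)\in\mathcal P$ and $\mathcal L_{\mathcal P'}(i,j)=\mathcal L_\mathcal P(i+1,j-1)$ otherwise, and inheritance along a path of simple ladder moves is defined inductively; it is independent of the chosen path. -}

module Defs where

open import Data.Bool using (Bool; true; false; if_then_else_; _∧_)
open import Data.Nat as ℕ using (ℕ; zero; suc; _∸_)
open import Data.Fin as Fin using (Fin; toℕ)
open import Data.Fin.Permutation using (Permutation′; _⟨$⟩ʳ_; _⟨$⟩ˡ_; flip)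
open import Data.List using (List; []; _∷_; length; filter; map; allFin; concatMap; head)
open import Data.Bool.ListAction using (any)
open import Data.Maybe using (Maybe; just; nothing)
open import Data.Product using (_×_; _,_; proj₁; proj₂)
open import Data.Product.Properties using (≡-dec)
open import Relation.Nullary using (does; ¬_)
open import Relation.Nullary.Decidable using (_×-dec_)
open import Relation.Binary.PropositionalEquality using (_≡_; _≢_)
open import Relation.Binary.Construct.Closure.ReflexiveTransitive using (Star; ε; _◅_)

-- All coordinates are 0-indexed: the paper's row/column i corresponds to i-1 here,
-- and w(k) corresponds to toℕ (w ⟨$⟩ʳ k) (value shifted down by 1).

Cell : Set
Cell = ℕ × ℕ

_≟c_ : (c d : Cell) → Relation.Nullary.Dec (c ≡ d)
_≟c_ = ≡-dec ℕ._≟_ ℕ._≟_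

-- A pipe dream: the (decidable) set of positions of its pluses.
PipeDream : Set
PipeDream = Cell → Bool

module _ {n : ℕ} (w : Permutation′ n) where

  diagram : List (Fin n × Fin n)
  diagram = filter (λ p → (proj₂ p Fin.<? (w ⟨$⟩ʳ proj₁ p)) ×-dec (proj₁ p Fin.<? (w ⟨$⟩ˡ proj₂ p)))
                   (concatMap (λ i → map (λ j → (i , j)) (allFin n)) (allFin n))

  rank : Fin n → Fin n → ℕ
  rank i j = length (filter (λ k → (k Fin.≤? i) ×-dec ((w ⟨$⟩ʳ k) Fin.≤? j)) (allFin n))

  code : Fin n → ℕ
  code i = length (filter (λ k → (i Fin.<? k) ×-dec ((w ⟨$⟩ʳ k) Fin.<? (w ⟨$⟩ʳ i))) (allFin n))

  -- bottom pipe dream: {(i,j) : j ≤ m_i(w)} (1-indexed), i.e. j < m_i(w) 0-indexed.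
  bottomPD : PipeDream
  bottomPD (i , j) = any (λ k → does (toℕ k ℕ.≟ i) ∧ does (j ℕ.<? code k)) (allFin n)

  topMap : Fin n × Fin n → Cell
  topMap (i , j) = (toℕ i ∸ rank i j , toℕ j)

  botMap : Fin n × Fin n → Cell
  botMap (i , j) = (toℕ i , toℕ j ∸ rank i j)

  botLabel : Cell → Maybe Cell
  botLabel c = Data.Maybe.map (λ d → (toℕ (proj₁ d) , toℕ (proj₂ d)))
                 (head (filter (λ d → botMap d ≟c c) diagram))

topPD : {n : ℕ} → Permutation′ n → PipeDream
topPD w (i , j) = bottomPD (flip w) (j , i)

-- Simple ladder move P ↦ Q: adds a plus at (i, j+1), removes the plus at (i+1, j),
-- with (i, j) and (i+1, j+1) elbows (0-indexed; paper's (i,j) ↦ (i+1,j-1)).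
data SimpleLadder (P Q : PipeDream) : Set where
  move : (i j : ℕ) →
         P (i , suc j) ≡ false →
         P (suc i , j) ≡ true →
         P (i , j) ≡ false →
         P (suc i , suc j) ≡ false →
         Q (i , suc j) ≡ true →
         Q (suc i , j) ≡ false →
         (∀ c → c ≢ (i , suc j) → c ≢ (suc i , j) → Q c ≡ P c) →
         SimpleLadder P Q

-- A labeling with label set I, stored as a total function; only its values on pluses matter.
Labeling : Set → Set
Labeling I = Cell → I

inheritStep : ∀ {I} {P Q : PipeDream} → SimpleLadder P Q → Labeling I → Labeling I
inheritStep {P = P} (move i j _ _ _ _ _ _ _) L c = if P c then L c else L (suc i , j)

inherit : ∀ {I} {P Q : PipeDream} → Star SimpleLadder P Q → Labeling I → Labeling I
inherit ε L = L
inherit (s ◅ ss) L = inherit ss (inheritStep s L)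

module Submission where

-- Cells are 0-indexed; anti-diagonal s consists of the cells (r , s ∸ r) with r ≤ s.
-- A simple ladder move carries the plus at (i+1 , j) to (i , j+1): it stays on its
-- anti-diagonal and keeps its place among the pluses of that anti-diagonal counted from
-- the top.  So along any path, the plus with k pluses above it on anti-diagonal s inherits
-- the label of the plus of B_w with k pluses above it on anti-diagonal s (inherits-along).
-- For (i , j) ∈ D(w) with r = r_w(i,j) the two images (i , j − r) ∈ B_w and
-- (i − r , j) ∈ T_w lie on the same anti-diagonal s = i + j − r, and on it both are
-- preceded by the same number of pluses, namely the number of cells of D(w) on the level
-- set {(a,b) : a + b − r_w(a,b) = s} lying in rows above i (pluses-above-agree).  Since a
-- plus is determined by its anti-diagonal and the number of pluses above it, the inherited
-- label of (i − r , j) is the label of (i , j − r) in B_w, which is (i , j).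

open import Defs
open import Data.Nat
open import Data.Nat.Properties
open import Algebra.Properties.CommutativeSemigroup +-commutativeSemigroup using (interchange)
open import Data.Bool using (Bool; true; false; T; _∧_; if_then_else_)
import Data.Bool.Properties as Bool
open import Data.Empty using (⊥; ⊥-elim)
open import Data.Fin as Fin using (Fin; toℕ; fromℕ<)
open import Data.Fin.Properties using (toℕ-fromℕ<; fromℕ<-toℕ; toℕ<n; toℕ-injective)
open import Data.Fin.Permutation using (Permutation′; _⟨$⟩ʳ_; _⟨$⟩ˡ_; flip; inverseˡ; inverseʳ)
open import Data.List using (_∷_; length; filter; map; allFin; tabulate; head; concatMap)
open import Data.List.Membership.Propositional using (_∈_; find; lose)
open import Data.List.Membership.Propositional.Properties using (∈-filter⁻; ∈-allFin)
open import Data.List.Relation.Unary.Any using (here; there)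
open import Data.List.Relation.Unary.Any.Properties using (any⁺; any⁻)
open import Data.Maybe as Maybe using (just)
open import Data.Product using (_×_; _,_; proj₁; proj₂)
open import Data.Sum using (_⊎_; inj₁; inj₂)
open import Function using (id)
open import Function.Bundles using (_⇔_; mk⇔; Equivalence)
open import Relation.Binary using (tri<; tri≈; tri>)
open import Relation.Binary.Construct.Closure.ReflexiveTransitive using (Star; ε; _◅_)
open import Relation.Binary.PropositionalEquality
open import Relation.Nullary using (Dec; yes; no; ¬_; does)
open import Relation.Nullary.Decidable using (_×-dec_; dec-true)
open import Relation.Unary using (Decidable)

-- The indicator 𝟙 d ∈ {0,1} of a decided proposition; it is kept abstract so that it is
-- only ever manipulated through the four lemmas below.
abstract
  𝟙 : ∀ {p} {P : Set p} → Dec P → ℕ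
  𝟙 (yes _) = 1
  𝟙 (no _)  = 0

  𝟙-yes : ∀ {p} {P : Set p} (d : Dec P) → P → 𝟙 d ≡ 1
  𝟙-yes (yes _) _  = refl
  𝟙-yes (no ¬p) p = ⊥-elim (¬p p)

  𝟙-no : ∀ {p} {P : Set p} (d : Dec P) → ¬ P → 𝟙 d ≡ 0
  𝟙-no (yes p) ¬p = ⊥-elim (¬p p)
  𝟙-no (no _)  _  = refl

  𝟙-iff : ∀ {p q} {P : Set p} {Q : Set q} (d : Dec P) (e : Dec Q) →
          (P → Q) → (Q → P) → 𝟙 d ≡ 𝟙 e
  𝟙-iff (yes p) e f g = sym (𝟙-yes e (f p))
  𝟙-iff (no ¬p) e f g = sym (𝟙-no e (λ q → ¬p (g q)))

  𝟙-pos : ∀ {p} {P : Set p} (d : Dec P) → 1 ≤ 𝟙 d → P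
  𝟙-pos (yes p) _ = p
  𝟙-pos (no _) ()

𝟙-<-or-≥ : ∀ x y → 𝟙 (x <? y) + 𝟙 (y ≤? x) ≡ 1
𝟙-<-or-≥ x y with x <? y
... | yes x<y = cong₂ _+_ (𝟙-yes (yes x<y) x<y) (𝟙-no (y ≤? x) (λ y≤x → <-irrefl refl (<-≤-trans x<y y≤x)))
... | no x≮y  = cong₂ _+_ (𝟙-no (no x≮y) x≮y) (𝟙-yes (y ≤? x) (≮⇒≥ x≮y))

𝟙-<-suc : ∀ c x → 𝟙 (c <? x) + 𝟙 (x ≟ c) ≡ 𝟙 (c <? x + 1)
𝟙-<-suc c x with <-cmp c x
... | tri< c<x c≢x _ = trans (cong₂ _+_ (𝟙-yes _ c<x) (𝟙-no _ (λ e → c≢x (sym e))))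
                             (sym (𝟙-yes _ (≤-trans c<x (m≤m+n x 1))))
... | tri≈ c≮x refl _ = trans (cong₂ _+_ (𝟙-no _ c≮x) (𝟙-yes _ refl))
                              (sym (𝟙-yes _ (subst (c <_) (+-comm 1 c) ≤-refl)))
... | tri> c≮x c≢x x<c = trans (cong₂ _+_ (𝟙-no _ c≮x) (𝟙-no _ (λ e → c≢x (sym e))))
                               (sym (𝟙-no _ (λ c<x+1 → <-irrefl refl
                                  (<-≤-trans x<c (≤-pred (subst (c <_) (+-comm x 1) c<x+1))))))

∑ : ℕ → (ℕ → ℕ) → ℕ
∑ zero    f = 0
∑ (suc m) f = ∑ m f + f m

∑-cong : ∀ m {f g : ℕ → ℕ} → (∀ r → r < m → f r ≡ g r) → ∑ m f ≡ ∑ m g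
∑-cong zero    h = refl
∑-cong (suc m) h = cong₂ _+_ (∑-cong m (λ r r<m → h r (m<n⇒m<1+n r<m))) (h m ≤-refl)

∑-zero : ∀ m {f : ℕ → ℕ} → (∀ r → r < m → f r ≡ 0) → ∑ m f ≡ 0
∑-zero m h = trans (∑-cong m h) (∑-const0 m)
  where
    ∑-const0 : ∀ m → ∑ m (λ _ → 0) ≡ 0
    ∑-const0 zero    = refl
    ∑-const0 (suc m) = cong (_+ 0) (∑-const0 m)

∑-const1 : ∀ m → ∑ m (λ _ → 1) ≡ m
∑-const1 zero    = refl
∑-const1 (suc m) = trans (cong (_+ 1) (∑-const1 m)) (+-comm m 1)

∑-+ : ∀ m (f g : ℕ → ℕ) → ∑ m (λ r → f r + g r) ≡ ∑ m f + ∑ m g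
∑-+ zero    f g = refl
∑-+ (suc m) f g = trans (cong (_+ (f m + g m)) (∑-+ m f g)) (interchange (∑ m f) (∑ m g) (f m) (g m))

∑-swap : ∀ m k (M : ℕ → ℕ → ℕ) → ∑ m (λ a → ∑ k (M a)) ≡ ∑ k (λ b → ∑ m (λ a → M a b))
∑-swap zero    k M = sym (∑-zero k (λ _ _ → refl))
∑-swap (suc m) k M = trans (cong (_+ ∑ k (M m)) (∑-swap m k M)) (sym (∑-+ k _ (M m)))

∑-vanishing-tail : ∀ k m {f : ℕ → ℕ} → m ≤ k → (∀ r → m ≤ r → r < k → f r ≡ 0) → ∑ k f ≡ ∑ m f
∑-vanishing-tail zero    zero    z≤n  h = refl
∑-vanishing-tail (suc k) m m≤1+k h with m≤n⇒m<n∨m≡n m≤1+k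
... | inj₂ refl  = refl
... | inj₁ m<1+k = trans (cong₂ _+_ (∑-vanishing-tail k m m≤k (λ r m≤r r<k → h r m≤r (m<n⇒m<1+n r<k)))
                                    (h k m≤k ≤-refl))
                         (+-identityʳ _)
  where
    m≤k : m ≤ k
    m≤k = m<1+n⇒m≤n m<1+k

∑-single : ∀ m e {f : ℕ → ℕ} → e < m → (∀ r → r < m → r ≢ e → f r ≡ 0) → ∑ m f ≡ f e
∑-single m e {f} e<m h = begin
    ∑ m f            ≡⟨ ∑-vanishing-tail m (suc e) e<m (λ r e<r r<m → h r r<m (λ r≡e → <-irrefl (sym r≡e) e<r)) ⟩
    ∑ e f + f e      ≡⟨ cong (_+ f e) (∑-zero e (λ r r<e → h r (<-trans r<e e<m) (<⇒≢ r<e))) ⟩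
    f e ∎
  where open ≡-Reasoning

∑-restrict : ∀ {m n} {P : ℕ → Set} (P? : ∀ k → Dec (P k)) → m ≤ n →
             ∑ n (λ k → 𝟙 ((k <? m) ×-dec P? k)) ≡ ∑ m (λ k → 𝟙 (P? k))
∑-restrict {m} {n} P? m≤n =
  trans (∑-vanishing-tail n m m≤n (λ r m≤r _ → 𝟙-no _ (λ (r<m , _) → <-irrefl refl (<-≤-trans r<m m≤r))))
        (∑-cong m (λ r r<m → 𝟙-iff _ _ proj₂ (λ pr → r<m , pr)))

∑-monoˡ : ∀ {m k} (f : ℕ → ℕ) → m ≤ k → ∑ m f ≤ ∑ k f
∑-monoˡ {m} {zero}  f z≤n   = ≤-refl
∑-monoˡ {m} {suc k} f m≤1+k with m≤n⇒m<n∨m≡n m≤1+k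
... | inj₂ refl  = ≤-refl
... | inj₁ m<1+k = ≤-trans (∑-monoˡ f (m<1+n⇒m≤n m<1+k)) (m≤m+n _ _)

∑-shift : ∀ m (f : ℕ → ℕ) → ∑ (suc m) f ≡ f 0 + ∑ m (λ r → f (suc r))
∑-shift zero    f = +-comm 0 (f 0)
∑-shift (suc m) f = trans (cong (_+ f (suc m)) (∑-shift m f)) (+-assoc (f 0) _ _)

∑-term : ∀ m (f : ℕ → ℕ) a → a < m → f a ≤ ∑ m f
∑-term (suc m) f a a<1+m with m≤n⇒m<n∨m≡n (m<1+n⇒m≤n a<1+m)
... | inj₂ refl = m≤n+m (f a) (∑ a f)
... | inj₁ a<m  = ≤-trans (∑-term m f a a<m) (m≤m+n _ _)

count-split : ∀ (f : ℕ → ℕ) a b → ∑ a (λ k → 𝟙 (f k <? b)) + ∑ a (λ k → 𝟙 (b ≤? f k)) ≡ a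
count-split f a b =
  trans (sym (∑-+ a _ _)) (trans (∑-cong a (λ k _ → 𝟙-<-or-≥ (f k) b)) (∑-const1 a))

-- Enumerating the elements of a decidable set Q below m in increasing order, each
-- c smaller than their number is the rank of exactly one of them.
rank-hits-once : ∀ {Q : ℕ → Set} (Q? : ∀ b → Dec (Q b)) m c →
                 ∑ m (λ b → 𝟙 (Q? b ×-dec (∑ b (λ v → 𝟙 (Q? v)) ≟ c))) ≡ 𝟙 (c <? ∑ m (λ v → 𝟙 (Q? v)))
rank-hits-once Q? zero c = sym (𝟙-no _ (λ ()))
rank-hits-once Q? (suc m) c with Q? m
... | yes q = begin
    ∑ m _ + 𝟙 (yes q ×-dec (size ≟ c)) ≡⟨ cong₂ _+_ (rank-hits-once Q? m c) (𝟙-iff _ _ proj₂ (λ e → q , e)) ⟩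
    𝟙 (c <? size) + 𝟙 (size ≟ c)        ≡⟨ 𝟙-<-suc c size ⟩
    𝟙 (c <? size + 1)                   ≡⟨ cong (λ z → 𝟙 (c <? size + z)) (sym (𝟙-yes (yes q) q)) ⟩
    𝟙 (c <? size + 𝟙 (yes q)) ∎
  where
    open ≡-Reasoning
    size : ℕ
    size = ∑ m (λ v → 𝟙 (Q? v))
... | no ¬q = begin
    ∑ m _ + 𝟙 (no ¬q ×-dec (size ≟ c)) ≡⟨ cong₂ _+_ (rank-hits-once Q? m c) (𝟙-no _ (λ x → ¬q (proj₁ x))) ⟩
    𝟙 (c <? size) + 0                   ≡⟨ +-identityʳ _ ⟩
    𝟙 (c <? size)                       ≡⟨ 𝟙-iff _ _ (subst (c <_) (sym (+-identityʳ _))) (subst (c <_) (+-identityʳ _)) ⟩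
    𝟙 (c <? size + 0)                   ≡⟨ cong (λ z → 𝟙 (c <? size + z)) (sym (𝟙-no (no ¬q) ¬q)) ⟩
    𝟙 (c <? size + 𝟙 (no ¬q)) ∎
  where
    open ≡-Reasoning
    size : ℕ
    size = ∑ m (λ v → 𝟙 (Q? v))

plus≢elbow : ∀ {b : Bool} → b ≡ true → b ≡ false → ⊥
plus≢elbow refl ()

differentRows : ∀ {r c r′ c′ : ℕ} → r ≢ r′ → (r , c) ≢ (r′ , c′)
differentRows r≢r′ e = r≢r′ (cong proj₁ e)

onDiagAbove : {P : ℕ → ℕ → Set} → (∀ r c → Dec (P r c)) → ℕ → ℕ → ℕ
onDiagAbove P? s a = ∑ a (λ r → 𝟙 ((r ≤? s) ×-dec P? r (s ∸ r)))

onDiagAbove-cong : ∀ {P P′ : ℕ → ℕ → Set} (P? : ∀ r c → Dec (P r c)) (P′? : ∀ r c → Dec (P′ r c)) →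
                   (∀ {r c} → P r c → P′ r c) → (∀ {r c} → P′ r c → P r c) →
                   ∀ s a → onDiagAbove P? s a ≡ onDiagAbove P′? s a
onDiagAbove-cong P? P′? to from s a =
  ∑-cong a (λ r _ → 𝟙-iff _ _ (λ (r≤s , p) → r≤s , to p) (λ (r≤s , p) → r≤s , from p))

isPlus : (Q : PipeDream) → ∀ r c → Dec (Q (r , c) ≡ true)
isPlus Q r c = Q (r , c) Bool.≟ true

plusAt : PipeDream → ℕ → ℕ → ℕ
plusAt Q s r = 𝟙 ((r ≤? s) ×-dec isPlus Q r (s ∸ r))

plusesAbove : PipeDream → ℕ → ℕ → ℕ
plusesAbove Q = onDiagAbove (isPlus Q)

cellOnDiag : ∀ {r s x y : ℕ} → r ≤ s → (r , s ∸ r) ≡ (x , y) → s ≡ x + y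
cellOnDiag r≤s e = trans (sym (m+[n∸m]≡n r≤s)) (cong₂ _+_ (cong proj₁ e) (cong proj₂ e))

plusOnDiag : ∀ Q {a b} → Q (a , b) ≡ true → plusAt Q (a + b) a ≡ 1
plusOnDiag Q {a} {b} q = 𝟙-yes _ (m≤m+n a b , subst (λ c → Q (a , c) ≡ true) (sym (m+n∸m≡n a b)) q)

plusesAbove-strict : ∀ Q s {x y} → plusAt Q s x ≡ 1 → x < y → plusesAbove Q s x < plusesAbove Q s y
plusesAbove-strict Q s {x} {y} plus-x x<y = begin-strict
    plusesAbove Q s x        <⟨ m<m+n _ (s≤s z≤n) ⟩
    plusesAbove Q s x + 1    ≡⟨ cong (plusesAbove Q s x +_) (sym plus-x) ⟩
    plusesAbove Q s (suc x)  ≤⟨ ∑-monoˡ (plusAt Q s) x<y ⟩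
    plusesAbove Q s y ∎
  where open ≤-Reasoning

plusesAbove-injective : ∀ Q s {x y} → plusAt Q s x ≡ 1 → plusAt Q s y ≡ 1 →
                        plusesAbove Q s x ≡ plusesAbove Q s y → x ≡ y
plusesAbove-injective Q s {x} {y} plus-x plus-y e with <-cmp x y
... | tri< x<y _ _ = ⊥-elim (<-irrefl e (plusesAbove-strict Q s plus-x x<y))
... | tri≈ _ x≡y _ = x≡y
... | tri> _ _ y<x = ⊥-elim (<-irrefl (sym e) (plusesAbove-strict Q s plus-y y<x))

-- A simple ladder move P ↦ Q carrying the plus at (i+1 , j) to (i , j+1); both cells lie
-- on anti-diagonal s₀ = i + j + 1.  Every other plus keeps its number of pluses above it.
module LadderMove (P Q : PipeDream) (i j : ℕ)
    (newP : P (i , suc j) ≡ false) (oldP : P (suc i , j) ≡ true)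
    (newQ : Q (i , suc j) ≡ true) (oldQ : Q (suc i , j) ≡ false)
    (elsewhere : ∀ c → c ≢ (i , suc j) → c ≢ (suc i , j) → Q c ≡ P c) where

  s₀ : ℕ
  s₀ = suc (i + j)

  plusAt-unmoved : ∀ s r → (r ≤ s → (r , s ∸ r) ≢ (i , suc j) × (r , s ∸ r) ≢ (suc i , j)) →
                   plusAt Q s r ≡ plusAt P s r
  plusAt-unmoved s r away with r ≤? s
  ... | no r≰s  = trans (𝟙-no _ (λ x → r≰s (proj₁ x))) (sym (𝟙-no _ (λ x → r≰s (proj₁ x))))
  ... | yes r≤s = cong (λ b → 𝟙 (yes r≤s ×-dec (b Bool.≟ true)))
                       (elsewhere _ (proj₁ (away r≤s)) (proj₂ (away r≤s)))

  plusesAbove-upTo : ∀ s a → a ≤ i → plusesAbove Q s a ≡ plusesAbove P s a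
  plusesAbove-upTo s a a≤i = ∑-cong a (λ r r<a → plusAt-unmoved s r (λ _ →
     differentRows (λ r≡i → <-irrefl r≡i (<-≤-trans r<a a≤i)) ,
     differentRows (λ r≡1+i → <-irrefl r≡1+i (<-≤-trans r<a (≤-trans a≤i (n≤1+n i))))))

  plusAt-Q-i : plusAt Q s₀ i ≡ 1
  plusAt-Q-i = trans (cong (λ s → plusAt Q s i) (sym (+-suc i j))) (plusOnDiag Q newQ)

  plusAt-P-1+i : plusAt P s₀ (suc i) ≡ 1
  plusAt-P-1+i = plusOnDiag P oldP

  plusAt-P-i : plusAt P s₀ i ≡ 0
  plusAt-P-i = 𝟙-no _ (λ (_ , plus) → plus≢elbow plus
    (subst (λ c → P (i , c) ≡ false) (sym (trans (cong (_∸ i) (sym (+-suc i j))) (m+n∸m≡n i (suc j)))) newP))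

  plusAt-Q-1+i : plusAt Q s₀ (suc i) ≡ 0
  plusAt-Q-1+i = 𝟙-no _ (λ (_ , plus) → plus≢elbow plus
    (subst (λ c → Q (suc i , c) ≡ false) (sym (m+n∸m≡n i j)) oldQ))

  plusesAbove-moved : plusesAbove Q s₀ i ≡ plusesAbove P s₀ (suc i)
  plusesAbove-moved = begin
      plusesAbove Q s₀ i             ≡⟨ plusesAbove-upTo s₀ i ≤-refl ⟩
      plusesAbove P s₀ i             ≡⟨ sym (+-identityʳ _) ⟩
      plusesAbove P s₀ i + 0         ≡⟨ cong (plusesAbove P s₀ i +_) (sym plusAt-P-i) ⟩
      plusesAbove P s₀ (suc i) ∎
    where open ≡-Reasoning

  plusesAbove-pastMove : ∀ a → suc (suc i) ≤ a → plusesAbove Q s₀ a ≡ plusesAbove P s₀ a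
  plusesAbove-pastMove (suc a) (s≤s 1+i≤a) with m≤n⇒m<n∨m≡n 1+i≤a
  ... | inj₂ refl = begin
      plusesAbove Q s₀ i + plusAt Q s₀ i + plusAt Q s₀ (suc i)
        ≡⟨ cong₂ (λ x y → plusesAbove Q s₀ i + x + y) plusAt-Q-i plusAt-Q-1+i ⟩
      plusesAbove Q s₀ i + 1 + 0
        ≡⟨ cong (λ x → x + 1 + 0) (plusesAbove-upTo s₀ i ≤-refl) ⟩
      plusesAbove P s₀ i + 1 + 0
        ≡⟨ trans (+-identityʳ _) (cong (_+ 1) (sym (+-identityʳ _))) ⟩
      plusesAbove P s₀ i + 0 + 1
        ≡⟨ sym (cong₂ (λ x y → plusesAbove P s₀ i + x + y) plusAt-P-i plusAt-P-1+i) ⟩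
      plusesAbove P s₀ i + plusAt P s₀ i + plusAt P s₀ (suc i) ∎
    where open ≡-Reasoning
  ... | inj₁ 1+i<a = cong₂ _+_ (plusesAbove-pastMove a 1+i<a)
                               (plusAt-unmoved s₀ a (λ _ →
                                  differentRows (λ a≡i → <-irrefl (sym a≡i) (<-trans (n<1+n i) 1+i<a)) ,
                                  differentRows (λ a≡1+i → <-irrefl (sym a≡1+i) 1+i<a)))

  plusesAbove-preserved : ∀ a b → Q (a , b) ≡ true → plusesAbove Q (a + b) a ≡ plusesAbove P (a + b) a
  plusesAbove-preserved a b plus with (a + b) ≟ s₀
  ... | no a+b≢s₀ = ∑-cong a (λ r _ → plusAt-unmoved (a + b) r (λ r≤s →
          (λ e → a+b≢s₀ (trans (cellOnDiag r≤s e) (+-suc i j))) , (λ e → a+b≢s₀ (cellOnDiag r≤s e))))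
  ... | yes a+b≡s₀ with a ≤? i | a ≟ suc i
  ...   | yes a≤i | _        = plusesAbove-upTo (a + b) a a≤i
  ...   | no _    | yes refl = ⊥-elim (plus≢elbow plus
          (subst (λ c → Q (suc i , c) ≡ false) (sym (+-cancelˡ-≡ i _ _ (suc-injective a+b≡s₀))) oldQ))
  ...   | no a≰i  | no a≢1+i = subst (λ s → plusesAbove Q s a ≡ plusesAbove P s a) (sym a+b≡s₀)
          (plusesAbove-pastMove a (≤∧≢⇒< (≰⇒> a≰i) (λ e → a≢1+i (sym e))))

record Descends {I : Set} (B : PipeDream) (L₀ : Labeling I) (Q : PipeDream) (L : Labeling I) (a b : ℕ) : Set where
  field
    srcRow srcCol : ℕ
    srcPlus   : B (srcRow , srcCol) ≡ true
    sameDiag  : srcRow + srcCol ≡ a + b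
    sameRank  : plusesAbove B (a + b) srcRow ≡ plusesAbove Q (a + b) a
    sameLabel : L (a , b) ≡ L₀ (srcRow , srcCol)

Inherits : {I : Set} → PipeDream → Labeling I → PipeDream → Labeling I → Set
Inherits B L₀ Q L = ∀ a b → Q (a , b) ≡ true → Descends B L₀ Q L a b

inherits-refl : ∀ {I : Set} (B : PipeDream) (L₀ : Labeling I) → Inherits B L₀ B L₀
inherits-refl B L₀ a b plus =
  record { srcRow = a ; srcCol = b ; srcPlus = plus ; sameDiag = refl ; sameRank = refl ; sameLabel = refl }

-- One simple ladder move preserves descent: the moved plus takes over the source of the
-- plus it replaces (plusesAbove-moved), all other pluses keep theirs (plusesAbove-preserved).
inherits-step : ∀ {I : Set} {B : PipeDream} {L₀ : Labeling I} {P Q : PipeDream} (m : SimpleLadder P Q)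
                {L : Labeling I} → Inherits B L₀ P L → Inherits B L₀ Q (inheritStep m L)
inherits-step {B = B} {P = P} {Q = Q} (move i j newP oldP _ _ newQ oldQ elsewhere) {L} inh a b plus
  with (a , b) ≟c (i , suc j)
... | yes refl = record
      { srcRow    = D.srcRow
      ; srcCol    = D.srcCol
      ; srcPlus   = D.srcPlus
      ; sameDiag  = trans D.sameDiag (sym (+-suc i j))
      ; sameRank  = subst (λ s → plusesAbove B s D.srcRow ≡ plusesAbove Q s i) (sym (+-suc i j))
                          (trans D.sameRank (sym plusesAbove-moved))
      ; sameLabel = trans (cong (λ x → if x then L (i , suc j) else L (suc i , j)) newP) D.sameLabel
      }
  where
    open LadderMove P Q i j newP oldP newQ oldQ elsewhere
    module D = Descends (inh (suc i) j oldP)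
... | no not-new = record
      { srcRow    = D.srcRow
      ; srcCol    = D.srcCol
      ; srcPlus   = D.srcPlus
      ; sameDiag  = D.sameDiag
      ; sameRank  = trans D.sameRank (sym (plusesAbove-preserved a b plus))
      ; sameLabel = trans (cong (λ x → if x then L (a , b) else L (suc i , j)) plusP) D.sameLabel
      }
  where
    open LadderMove P Q i j newP oldP newQ oldQ elsewhere
    plusP : P (a , b) ≡ true
    plusP = trans (sym (elsewhere (a , b) not-new (λ e → plus≢elbow plus (trans (cong Q e) oldQ)))) plus
    module D = Descends (inh a b plusP)

inherits-along : ∀ {I : Set} {B : PipeDream} {L₀ : Labeling I} {P Q : PipeDream}
                 (path : Star SimpleLadder P Q) {L : Labeling I} →
                 Inherits B L₀ P L → Inherits B L₀ Q (inherit path L)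
inherits-along ε        inh = inh
inherits-along (m ◅ ms) inh = inherits-along ms (inherits-step m inh)

record ℕPerm (n : ℕ) : Set where
  field
    w w⁻¹ : ℕ → ℕ
    w<n   : ∀ {k} → k < n → w k < n
    w⁻¹<n : ∀ {v} → v < n → w⁻¹ v < n
    w⁻¹∘w : ∀ k → w⁻¹ (w k) ≡ k
    w∘w⁻¹ : ∀ v → w (w⁻¹ v) ≡ v

inverse : ∀ {n} → ℕPerm n → ℕPerm n
inverse p = record { w = w⁻¹ ; w⁻¹ = w ; w<n = w⁻¹<n ; w⁻¹<n = w<n ; w⁻¹∘w = w∘w⁻¹ ; w∘w⁻¹ = w⁻¹∘w }
  where open ℕPerm p

-- For a cell (a , b) of the
-- Rothe diagram with r = r_w(a,b) (0-indexed), topRow a b = a − r and botCol a b = b − r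
-- are the coordinates of its images in T_w and B_w, both on anti-diagonal diag a b.
module PermStatistics {n : ℕ} (p : ℕPerm n) where
  open ℕPerm p

  InD : ℕ → ℕ → Set
  InD a b = a < n × b < n × b < w a × a < w⁻¹ b

  InD? : ∀ a b → Dec (InD a b)
  InD? a b = (a <? n) ×-dec (b <? n) ×-dec (b <? w a) ×-dec (a <? w⁻¹ b)

  InD⇒a≤n : ∀ {a b} → InD a b → a ≤ n
  InD⇒a≤n (a<n , _) = <⇒≤ a<n

  InD⇒b≤n : ∀ {a b} → InD a b → b ≤ n
  InD⇒b≤n (_ , b<n , _) = <⇒≤ b<n

  r r′ : ℕ → ℕ → ℕ
  r  a b = ∑ a (λ k → 𝟙 (w k <? b))
  r′ a b = ∑ b (λ v → 𝟙 (w⁻¹ v <? a))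

  topRow botCol : ℕ → ℕ → ℕ
  topRow a b = ∑ a (λ k → 𝟙 (b ≤? w k))
  botCol a b = ∑ b (λ v → 𝟙 (a ≤? w⁻¹ v))

  diag : ℕ → ℕ → ℕ
  diag a b = topRow a b + b

  lehmer : ℕ → ℕ
  lehmer a = ∑ n (λ k → 𝟙 ((a <? k) ×-dec (w k <? w a)))

  ∑-reindex : (f : ℕ → ℕ) → ∑ n f ≡ ∑ n (λ v → f (w⁻¹ v))
  ∑-reindex f = begin
      ∑ n f                          ≡⟨ ∑-cong n as-row ⟩
      ∑ n (λ k → ∑ n (λ v → M k v))  ≡⟨ ∑-swap n n M ⟩
      ∑ n (λ v → ∑ n (λ k → M k v))  ≡⟨ ∑-cong n as-column ⟩
      ∑ n (λ v → f (w⁻¹ v)) ∎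
    where
      open ≡-Reasoning
      -- the permutation matrix of w⁻¹ weighted by f
      M : ℕ → ℕ → ℕ
      M k v = 𝟙 (k ≟ w⁻¹ v) * f (w⁻¹ v)
      as-row : ∀ k → k < n → f k ≡ ∑ n (M k)
      as-row k k<n = sym (trans
        (∑-single n (w k) (w<n k<n)
          (λ v _ v≢wk → cong (_* f (w⁻¹ v)) (𝟙-no _ (λ k≡ → v≢wk (trans (sym (w∘w⁻¹ v)) (cong w (sym k≡)))))))
        (trans (cong₂ _*_ (𝟙-yes _ (sym (w⁻¹∘w k))) (cong f (w⁻¹∘w k))) (+-identityʳ _)))
      as-column : ∀ v → v < n → ∑ n (λ k → M k v) ≡ f (w⁻¹ v)
      as-column v v<n = trans
        (∑-single n (w⁻¹ v) (w⁻¹<n v<n) (λ k _ k≢ → cong (_* f (w⁻¹ v)) (𝟙-no _ k≢)))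
        (trans (cong (_* f (w⁻¹ v)) (𝟙-yes _ refl)) (+-identityʳ _))

  r+topRow : ∀ a b → r a b + topRow a b ≡ a
  r+topRow a b = count-split w a b

  r′+botCol : ∀ a b → r′ a b + botCol a b ≡ b
  r′+botCol a b = count-split w⁻¹ b a

  r≡r′ : ∀ a b → a ≤ n → b ≤ n → r a b ≡ r′ a b
  r≡r′ a b a≤n b≤n = begin
      r a b                                          ≡⟨ sym (∑-restrict (λ k → w k <? b) a≤n) ⟩
      ∑ n (λ k → 𝟙 ((k <? a) ×-dec (w k <? b)))      ≡⟨ ∑-reindex _ ⟩
      ∑ n (λ v → 𝟙 ((w⁻¹ v <? a) ×-dec (w (w⁻¹ v) <? b)))
        ≡⟨ ∑-cong n (λ v _ → 𝟙-iff _ _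
             (λ (x , y) → subst (_< b) (w∘w⁻¹ v) y , x) (λ (x , y) → y , subst (_< b) (sym (w∘w⁻¹ v)) x)) ⟩
      ∑ n (λ v → 𝟙 ((v <? b) ×-dec (w⁻¹ v <? a)))    ≡⟨ ∑-restrict (λ v → w⁻¹ v <? a) b≤n ⟩
      r′ a b ∎
    where open ≡-Reasoning

  diag-botCol : ∀ a b → a ≤ n → b ≤ n → diag a b ≡ a + botCol a b
  diag-botCol a b a≤n b≤n = begin
      topRow a b + b                        ≡⟨ cong (topRow a b +_) (sym (r′+botCol a b)) ⟩
      topRow a b + (r′ a b + botCol a b)    ≡⟨ cong (λ z → topRow a b + (z + botCol a b)) (sym (r≡r′ a b a≤n b≤n)) ⟩
      topRow a b + (r a b + botCol a b)     ≡⟨ sym (+-assoc (topRow a b) _ _) ⟩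
      topRow a b + r a b + botCol a b       ≡⟨ cong (_+ botCol a b) (+-comm (topRow a b) _) ⟩
      r a b + topRow a b + botCol a b       ≡⟨ cong (_+ botCol a b) (r+topRow a b) ⟩
      a + botCol a b ∎
    where open ≡-Reasoning

  diag-monoˡ : ∀ {a a′} b → a ≤ a′ → diag a b ≤ diag a′ b
  diag-monoˡ b a≤a′ = +-monoˡ-≤ b (∑-monoˡ _ a≤a′)

  diag-monoʳ : ∀ a {b b′} → a ≤ n → b ≤ b′ → b′ ≤ n → diag a b ≤ diag a b′
  diag-monoʳ a {b} {b′} a≤n b≤b′ b′≤n = begin
      diag a b         ≡⟨ diag-botCol a b a≤n (≤-trans b≤b′ b′≤n) ⟩
      a + botCol a b   ≤⟨ +-monoʳ-≤ a (∑-monoˡ _ b≤b′) ⟩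
      a + botCol a b′  ≡⟨ sym (diag-botCol a b′ a≤n b′≤n) ⟩
      diag a b′ ∎
    where open ≤-Reasoning

  diag-strict : ∀ {a b a′ b′} → InD a b → a ≤ a′ → b ≤ b′ → a′ ≤ n → b′ ≤ n →
                a < a′ ⊎ b < b′ → diag a b < diag a′ b′
  diag-strict {a} {b} {a′} {b′} (_ , _ , b<wa , _) _ b≤b′ a′≤n b′≤n (inj₁ a<a′) = begin-strict
      topRow a b + b                  <⟨ +-monoˡ-< b (m<m+n (topRow a b) (s≤s z≤n)) ⟩
      topRow a b + 1 + b              ≡⟨ cong (λ z → topRow a b + z + b) (sym (𝟙-yes (b ≤? w a) (<⇒≤ b<wa))) ⟩
      diag (suc a) b                  ≤⟨ diag-monoˡ b a<a′ ⟩
      diag a′ b                       ≤⟨ diag-monoʳ a′ a′≤n b≤b′ b′≤n ⟩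
      diag a′ b′ ∎
    where open ≤-Reasoning
  diag-strict {a} {b} {a′} {b′} (a<n , b<n , _ , a<w⁻¹b) a≤a′ _ _ b′≤n (inj₂ b<b′) = begin-strict
      diag a b                        ≡⟨ diag-botCol a b (<⇒≤ a<n) (<⇒≤ b<n) ⟩
      a + botCol a b                  <⟨ +-monoʳ-< a (m<m+n (botCol a b)
                                           (subst (0 <_) (sym (𝟙-yes (a ≤? w⁻¹ b) (<⇒≤ a<w⁻¹b))) (s≤s z≤n))) ⟩
      a + botCol a (suc b)            ≡⟨ sym (diag-botCol a (suc b) (<⇒≤ a<n) (≤-trans b<b′ b′≤n)) ⟩
      diag a (suc b)                  ≤⟨ diag-monoʳ a (<⇒≤ a<n) b<b′ b′≤n ⟩
      diag a b′                       ≤⟨ diag-monoˡ b′ a≤a′ ⟩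
      diag a′ b′ ∎
    where open ≤-Reasoning

  level-sameRow : ∀ {a b b′} → InD a b → InD a b′ → diag a b ≡ diag a b′ → b ≡ b′
  level-sameRow {a} {b} {b′} ab ab′ e with <-cmp b b′
  ... | tri< b<b′ _ _ =
        ⊥-elim (<-irrefl e (diag-strict ab ≤-refl (<⇒≤ b<b′) (InD⇒a≤n ab′) (InD⇒b≤n ab′) (inj₂ b<b′)))
  ... | tri≈ _ b≡b′ _ = b≡b′
  ... | tri> _ _ b′<b =
        ⊥-elim (<-irrefl (sym e) (diag-strict ab′ ≤-refl (<⇒≤ b′<b) (InD⇒a≤n ab) (InD⇒b≤n ab) (inj₂ b′<b)))

  level-row<⇒topRow< : ∀ {a b a′ b′} → InD a b → InD a′ b′ → diag a b ≡ diag a′ b′ → a < a′ →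
                       topRow a b < topRow a′ b′
  level-row<⇒topRow< {a} {b} {a′} {b′} ab a′b′ e a<a′ with topRow a b <? topRow a′ b′ | b′ <? b
  ... | yes t<t′ | _     = t<t′
  ... | no t≮t′  | yes b′<b = ⊥-elim (<-irrefl (sym e) (+-mono-≤-< (≮⇒≥ t≮t′) b′<b))
  ... | no _     | no b′≮b  =
        ⊥-elim (<-irrefl e (diag-strict ab (<⇒≤ a<a′) (≮⇒≥ b′≮b) (InD⇒a≤n a′b′) (InD⇒b≤n a′b′) (inj₁ a<a′)))

  level-topRow<⇒row< : ∀ {a b a′ b′} → InD a b → InD a′ b′ → diag a b ≡ diag a′ b′ →
                       topRow a b < topRow a′ b′ → a < a′
  level-topRow<⇒row< {a} {b} {a′} {b′} ab a′b′ e t<t′ with <-cmp a a′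
  ... | tri< a<a′ _ _ = a<a′
  ... | tri≈ _ refl _ = ⊥-elim (<-irrefl (cong (topRow a) (level-sameRow ab a′b′ e)) t<t′)
  ... | tri> _ _ a′<a = ⊥-elim (<-asym t<t′ (level-row<⇒topRow< a′b′ ab (sym e) a′<a))

  lehmer≡botCol : ∀ a → a < n → lehmer a ≡ botCol a (w a)
  lehmer≡botCol a a<n = begin
      lehmer a  ≡⟨ ∑-reindex _ ⟩
      ∑ n (λ v → 𝟙 ((a <? w⁻¹ v) ×-dec (w (w⁻¹ v) <? w a)))
        ≡⟨ ∑-cong n (λ v _ → 𝟙-iff _ _
             (λ (x , y) → subst (_< w a) (w∘w⁻¹ v) y , <⇒≤ x)
             (λ (x , y) → ≤∧≢⇒< y (λ e → <-irrefl (trans (sym (w∘w⁻¹ v)) (cong w (sym e))) x) ,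
                          subst (_< w a) (sym (w∘w⁻¹ v)) x)) ⟩
      ∑ n (λ v → 𝟙 ((v <? w a) ×-dec (a ≤? w⁻¹ v)))  ≡⟨ ∑-restrict (λ v → a ≤? w⁻¹ v) (<⇒≤ (w<n a<n)) ⟩
      botCol a (w a) ∎
    where open ≡-Reasoning

  lehmer-row : ∀ a c → a < n → 𝟙 (c <? lehmer a) ≡ ∑ n (λ b → 𝟙 (InD? a b ×-dec (botCol a b ≟ c)))
  lehmer-row a c a<n = sym (begin
      ∑ n (λ b → 𝟙 (InD? a b ×-dec (botCol a b ≟ c)))
        ≡⟨ ∑-vanishing-tail n (w a) (<⇒≤ (w<n a<n))
             (λ b wa≤b _ → 𝟙-no _ (λ ((_ , _ , b<wa , _) , _) → <-irrefl refl (<-≤-trans b<wa wa≤b))) ⟩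
      ∑ (w a) (λ b → 𝟙 (InD? a b ×-dec (botCol a b ≟ c)))
        ≡⟨ ∑-cong (w a) (λ b b<wa → 𝟙-iff _ _
             (λ ((_ , _ , _ , a<w⁻¹b) , e) → <⇒≤ a<w⁻¹b , e)
             (λ (a≤w⁻¹b , e) → (a<n , <-trans b<wa (w<n a<n) , b<wa ,
                  ≤∧≢⇒< a≤w⁻¹b (λ a≡ → <-irrefl (trans (sym (w∘w⁻¹ b)) (cong w (sym a≡))) b<wa)) , e)) ⟩
      ∑ (w a) (λ b → 𝟙 ((a ≤? w⁻¹ b) ×-dec (botCol a b ≟ c)))
        ≡⟨ rank-hits-once (λ b → a ≤? w⁻¹ b) (w a) c ⟩
      𝟙 (c <? botCol a (w a))
        ≡⟨ cong (λ z → 𝟙 (c <? z)) (sym (lehmer≡botCol a a<n)) ⟩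
      𝟙 (c <? lehmer a) ∎)
    where open ≡-Reasoning

-- For (i , j) ∈ D(w) on anti-diagonal s = diag i j, the pluses of
-- B_w above row i and the pluses of T_w above row topRow i j on anti-diagonal s are both
-- in bijection with the cells of D(w) on the level set diag = s lying above (i , j).
module AntidiagonalCount {n : ℕ} (p : ℕPerm n) where
  open ℕPerm p
  open PermStatistics p
  module Inv = PermStatistics (inverse p)

  InB InT : ℕ → ℕ → Set
  InB a b = a < n × b < lehmer a
  InT a b = b < n × a < Inv.lehmer b

  InB? : ∀ a b → Dec (InB a b)
  InB? a b = (a <? n) ×-dec (b <? lehmer a)

  InT? : ∀ a b → Dec (InT a b)
  InT? a b = (b <? n) ×-dec (a <? Inv.lehmer b)

  module _ {i j : ℕ} (ij : InD i j) where
    s : ℕ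
    s = diag i j

    onLevel : ℕ → ℕ → ℕ
    onLevel a b = 𝟙 (InD? a b ×-dec (diag a b ≟ s))

    precedes : ℕ → ℕ → ℕ
    precedes a b = 𝟙 (InD? a b ×-dec ((topRow a b <? topRow i j) ×-dec (b + topRow a b ≟ s)))

    hasTopRow : ℕ → ℕ → ℕ → ℕ
    hasTopRow x b a = 𝟙 ((b + x ≟ s) ×-dec (InD? a b ×-dec (topRow a b ≟ x)))

    B-row-count : ∀ r → r < i → 𝟙 ((r ≤? s) ×-dec InB? r (s ∸ r)) ≡ ∑ n (onLevel r)
    B-row-count r r<i with r ≤? s
    ... | no r≰s = trans (𝟙-no _ (λ x → r≰s (proj₁ x)))
                         (sym (∑-zero n (λ b _ → 𝟙-no _ (λ (rb , e) →
                            r≰s (subst (r ≤_) (trans (sym (diag-botCol r b (InD⇒a≤n rb) (InD⇒b≤n rb))) e)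
                                               (m≤m+n r _))))))
    ... | yes r≤s = begin
        𝟙 (yes r≤s ×-dec InB? r (s ∸ r))  ≡⟨ 𝟙-iff _ _ (λ x → proj₂ (proj₂ x)) (λ x → r≤s , r<n , x) ⟩
        𝟙 (s ∸ r <? lehmer r)              ≡⟨ lehmer-row r (s ∸ r) r<n ⟩
        ∑ n (λ b → 𝟙 (InD? r b ×-dec (botCol r b ≟ s ∸ r)))
          ≡⟨ ∑-cong n (λ b _ → 𝟙-iff _ _
               (λ (rb , e) → rb , trans (diag-botCol r b (InD⇒a≤n rb) (InD⇒b≤n rb))
                                        (trans (cong (r +_) e) (m+[n∸m]≡n r≤s)))
               (λ (rb , e) → rb , trans (sym (m+n∸m≡n r (botCol r b)))
                                        (cong (_∸ r) (trans (sym (diag-botCol r b (InD⇒a≤n rb) (InD⇒b≤n rb))) e)))) ⟩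
        ∑ n (onLevel r) ∎
      where
        open ≡-Reasoning
        r<n : r < n
        r<n = <-trans r<i (proj₁ ij)

    B-count : onDiagAbove InB? s i ≡ ∑ n (λ a → ∑ n (precedes a))
    B-count = begin
        onDiagAbove InB? s i                 ≡⟨ ∑-cong i B-row-count ⟩
        ∑ i (λ r → ∑ n (onLevel r))
          ≡⟨ sym (∑-cong i (λ r r<i → ∑-cong n (λ b _ → 𝟙-iff _ _ proj₂ (λ x → r<i , x)))) ⟩
        ∑ i (λ r → ∑ n (λ b → 𝟙 ((r <? i) ×-dec (InD? r b ×-dec (diag r b ≟ s)))))
          ≡⟨ sym (∑-vanishing-tail n i (InD⇒a≤n ij) (λ r i≤r _ → ∑-zero n (λ b _ → 𝟙-no _
               (λ x → <-irrefl refl (<-≤-trans (proj₁ x) i≤r))))) ⟩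
        ∑ n (λ r → ∑ n (λ b → 𝟙 ((r <? i) ×-dec (InD? r b ×-dec (diag r b ≟ s)))))
          ≡⟨ ∑-cong n (λ a _ → ∑-cong n (λ b _ → 𝟙-iff _ _
               (λ (a<i , ab , e) → ab , level-row<⇒topRow< ab ij e a<i , trans (+-comm b _) e)
               (λ (ab , t<t′ , e) → level-topRow<⇒row< ab ij (trans (+-comm _ b) e) t<t′ , ab ,
                                     trans (+-comm _ b) e))) ⟩
        ∑ n (λ a → ∑ n (precedes a)) ∎
      where open ≡-Reasoning

    T-row-count : ∀ x → 𝟙 ((x ≤? s) ×-dec InT? x (s ∸ x)) ≡ ∑ n (λ b → ∑ n (hasTopRow x b))
    T-row-count x with (x ≤? s) ×-dec (s ∸ x <? n)
    ... | no out = trans (𝟙-no _ (λ (x≤s , b<n , _) → out (x≤s , b<n)))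
                         (sym (∑-zero n (λ b _ → ∑-zero n (λ a _ → 𝟙-no _ (λ (e , ab , _) →
                            out (x≤s e , subst (_< n) (sym (s∸x e)) (proj₁ (proj₂ ab))))))))
      where
        x≤s : ∀ {b} → b + x ≡ s → x ≤ s
        x≤s {b} e = subst (x ≤_) (trans (+-comm x b) e) (m≤m+n x b)
        s∸x : ∀ {b} → b + x ≡ s → s ∸ x ≡ b
        s∸x {b} e = trans (cong (_∸ x) (sym e)) (m+n∸n≡m b x)
    ... | yes (x≤s , s∸x<n) = begin
        𝟙 ((x ≤? s) ×-dec InT? x (s ∸ x))  ≡⟨ 𝟙-iff _ _ (λ z → proj₂ (proj₂ z)) (λ z → x≤s , s∸x<n , z) ⟩
        𝟙 (x <? Inv.lehmer (s ∸ x))        ≡⟨ Inv.lehmer-row (s ∸ x) x s∸x<n ⟩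
        ∑ n (λ a → 𝟙 (Inv.InD? (s ∸ x) a ×-dec (topRow a (s ∸ x) ≟ x)))
          ≡⟨ ∑-cong n (λ a _ → 𝟙-iff _ _
               (λ ((h₁ , h₂ , h₃ , h₄) , e) → m∸n+n≡m x≤s , (h₂ , h₁ , h₄ , h₃) , e)
               (λ (_ , (h₁ , h₂ , h₃ , h₄) , e) → (h₂ , h₁ , h₄ , h₃) , e)) ⟩
        ∑ n (hasTopRow x (s ∸ x))
          ≡⟨ sym (∑-single n (s ∸ x) s∸x<n (λ b _ b≢ → ∑-zero n (λ a _ → 𝟙-no _
               (λ (e , _) → b≢ (trans (sym (m+n∸n≡m b x)) (cong (_∸ x) e)))))) ⟩
        ∑ n (λ b → ∑ n (hasTopRow x b)) ∎
      where open ≡-Reasoning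

    topRow-selects : ∀ a b → ∑ (topRow i j) (λ x → hasTopRow x b a) ≡ precedes a b
    topRow-selects a b with topRow a b <? topRow i j
    ... | yes t<t′ = trans (∑-single (topRow i j) (topRow a b) t<t′ (λ x _ x≢ → 𝟙-no _ (λ (_ , _ , e) → x≢ (sym e))))
                           (𝟙-iff _ _ (λ (e , ab , _) → ab , t<t′ , e) (λ (ab , _ , e) → e , ab , refl))
    ... | no t≮t′  = trans (∑-zero (topRow i j) (λ x x<t′ → 𝟙-no _
                               (λ (_ , _ , e) → t≮t′ (subst (_< topRow i j) (sym e) x<t′))))
                           (sym (𝟙-no _ (λ (_ , t<t′ , _) → t≮t′ t<t′)))

    T-count : onDiagAbove InT? s (topRow i j) ≡ ∑ n (λ a → ∑ n (precedes a))
    T-count = begin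
        onDiagAbove InT? s (topRow i j)                    ≡⟨ ∑-cong (topRow i j) (λ x _ → T-row-count x) ⟩
        ∑ (topRow i j) (λ x → ∑ n (λ b → ∑ n (hasTopRow x b))) ≡⟨ ∑-swap (topRow i j) n _ ⟩
        ∑ n (λ b → ∑ (topRow i j) (λ x → ∑ n (hasTopRow x b))) ≡⟨ ∑-cong n (λ b _ → ∑-swap (topRow i j) n _) ⟩
        ∑ n (λ b → ∑ n (λ a → ∑ (topRow i j) (λ x → hasTopRow x b a)))
          ≡⟨ ∑-cong n (λ b _ → ∑-cong n (λ a _ → topRow-selects a b)) ⟩
        ∑ n (λ b → ∑ n (λ a → precedes a b))               ≡⟨ ∑-swap n n _ ⟩
        ∑ n (λ a → ∑ n (precedes a)) ∎
      where open ≡-Reasoning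

    pluses-above-agree : onDiagAbove InB? s i ≡ onDiagAbove InT? s (topRow i j)
    pluses-above-agree = trans B-count (sym T-count)

-- A permutation w ∈ S_n as a function on ℕ, extended by the identity outside {0,…,n−1}.
extend : ∀ {n} → Permutation′ n → ℕ → ℕ
extend {n} π k with k <? n
... | yes k<n = toℕ (π ⟨$⟩ʳ fromℕ< k<n)
... | no _    = k

extend-toℕ : ∀ {n} (π : Permutation′ n) (x : Fin n) → extend π (toℕ x) ≡ toℕ (π ⟨$⟩ʳ x)
extend-toℕ {n} π x with toℕ x <? n
... | yes x<n = cong (λ y → toℕ (π ⟨$⟩ʳ y)) (fromℕ<-toℕ x x<n)
... | no x≮n  = ⊥-elim (x≮n (toℕ<n x))

extend-<n : ∀ {n} (π : Permutation′ n) {k} → k < n → extend π k < n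
extend-<n {n} π {k} k<n with k <? n
... | yes _   = toℕ<n _
... | no k≮n = ⊥-elim (k≮n k<n)

extend-out : ∀ {n} (π : Permutation′ n) {k} → ¬ k < n → extend π k ≡ k
extend-out {n} π {k} k≮n with k <? n
... | yes k<n = ⊥-elim (k≮n k<n)
... | no _    = refl

extend-inverse : ∀ {n} (π σ : Permutation′ n) → (∀ x → σ ⟨$⟩ʳ (π ⟨$⟩ʳ x) ≡ x) →
                 ∀ k → extend σ (extend π k) ≡ k
extend-inverse {n} π σ σ∘π k with k <? n
... | yes k<n = trans (extend-toℕ σ _) (trans (cong toℕ (σ∘π _)) (toℕ-fromℕ< k<n))
... | no k≮n  = extend-out σ k≮n

asℕPerm : ∀ {n} → Permutation′ n → ℕPerm n
asℕPerm w = record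
  { w     = extend w
  ; w⁻¹   = extend (flip w)
  ; w<n   = extend-<n w
  ; w⁻¹<n = extend-<n (flip w)
  ; w⁻¹∘w = extend-inverse w (flip w) (λ _ → inverseˡ w)
  ; w∘w⁻¹ = extend-inverse (flip w) w (λ _ → inverseʳ w)
  }

length-filter-tabulate : ∀ {n} {A : Set} {P : A → Set} (P? : Decidable P) (h : Fin n → A) (g : ℕ → ℕ) →
                         (∀ k → 𝟙 (P? (h k)) ≡ g (toℕ k)) → length (filter P? (tabulate h)) ≡ ∑ n g
length-filter-tabulate {zero}  P? h g hg = refl
length-filter-tabulate {suc n} P? h g hg with P? (h Fin.zero) | hg Fin.zero
... | yes p | g0 = trans (cong suc (length-filter-tabulate P? (λ k → h (Fin.suc k)) (λ r → g (suc r)) (λ k → hg (Fin.suc k))))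
                         (trans (cong (_+ ∑ n (λ r → g (suc r))) (trans (sym (𝟙-yes (yes p) p)) g0)) (sym (∑-shift n g)))
... | no ¬p | g0 = trans (length-filter-tabulate P? (λ k → h (Fin.suc k)) (λ r → g (suc r)) (λ k → hg (Fin.suc k)))
                         (trans (cong (_+ ∑ n (λ r → g (suc r))) (trans (sym (𝟙-no (no ¬p) ¬p)) g0)) (sym (∑-shift n g)))

code≡lehmer : ∀ {n} (π : Permutation′ n) (i : Fin n) → code π i ≡ PermStatistics.lehmer (asℕPerm π) (toℕ i)
code≡lehmer {n} π i = length-filter-tabulate (λ k → (i Fin.<? k) ×-dec ((π ⟨$⟩ʳ k) Fin.<? (π ⟨$⟩ʳ i))) id
  (λ k → 𝟙 ((toℕ i <? k) ×-dec (extend π k <? extend π (toℕ i)))) (λ k → 𝟙-iff _ _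
  (λ (x , y) → x , subst₂ _<_ (sym (extend-toℕ π k)) (sym (extend-toℕ π i)) y)
  (λ (x , y) → x , subst₂ _<_ (extend-toℕ π k) (extend-toℕ π i) y))

does⇒ : ∀ {A : Set} (d : Dec A) → T (does d) → A
does⇒ (yes a) _ = a

⇒does : ∀ {A : Set} (d : Dec A) → A → T (does d)
⇒does d a = Equivalence.from Bool.T-≡ (dec-true d a)

bottomPD-iff : ∀ {n} (π : Permutation′ n) a b →
               bottomPD π (a , b) ≡ true ⇔ (a < n × b < PermStatistics.lehmer (asℕPerm π) a)
bottomPD-iff {n} π a b = mk⇔ to from
  where
    rowHas : Fin n → Bool
    rowHas k = does (toℕ k ≟ a) ∧ does (b <? code π k)
    to : bottomPD π (a , b) ≡ true → a < n × b < PermStatistics.lehmer (asℕPerm π) a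
    to plus with find (any⁻ rowHas (allFin n) (Equivalence.from Bool.T-≡ plus))
    ... | k , _ , has with Equivalence.to Bool.T-∧ has
    ...   | k≡a , b<code with does⇒ (toℕ k ≟ a) k≡a
    ...     | refl = toℕ<n k , subst (b <_) (code≡lehmer π k) (does⇒ (b <? code π k) b<code)
    from : a < n × b < PermStatistics.lehmer (asℕPerm π) a → bottomPD π (a , b) ≡ true
    from (a<n , b<m) = Equivalence.to Bool.T-≡ (any⁺ rowHas (lose (∈-allFin k) (Equivalence.from Bool.T-∧
      (⇒does (toℕ k ≟ a) (toℕ-fromℕ< a<n) ,
       ⇒does (b <? code π k) (subst (b <_) (sym (trans (code≡lehmer π k)
                                (cong (PermStatistics.lehmer (asℕPerm π)) (toℕ-fromℕ< a<n)))) b<m)))))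
      where
        k : Fin n
        k = fromℕ< a<n

head-filter-unique : ∀ {A : Set} {P : A → Set} (P? : Decidable P) xs d → d ∈ xs → P d →
                     (∀ y → y ∈ xs → P y → y ≡ d) → head (filter P? xs) ≡ just d
head-filter-unique P? (x ∷ xs) d d∈ pd unique with P? x
... | yes px = cong just (unique x (here refl) px)
... | no ¬px with d∈
...   | here refl = ⊥-elim (¬px pd)
...   | there d∈xs = head-filter-unique P? xs d d∈xs pd (λ y y∈ py → unique y (there y∈) py)

module ForPermutation {n : ℕ} (w : Permutation′ n) where
  open PermStatistics (asℕPerm w)
  open AntidiagonalCount (asℕPerm w) using (InB?; InT?; pluses-above-agree; module Inv)

  diagram⇒InD : ∀ {i j} → (i , j) ∈ diagram w → InD (toℕ i) (toℕ j)
  diagram⇒InD {i} {j} ij∈D with ∈-filter⁻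
                                  (λ q → (proj₂ q Fin.<? (w ⟨$⟩ʳ proj₁ q)) ×-dec (proj₁ q Fin.<? (w ⟨$⟩ˡ proj₂ q)))
                                  {xs = concatMap (λ i → map (λ j → (i , j)) (allFin n)) (allFin n)} ij∈D
  ... | _ , (j<wi , i<w⁻¹j) = toℕ<n i , toℕ<n j , subst (toℕ j <_) (sym (extend-toℕ w i)) j<wi ,
                              subst (toℕ i <_) (sym (extend-toℕ (flip w) j)) i<w⁻¹j

  -- On the diagram, r_w(i,j) only counts rows strictly above i and values strictly below j.
  rank≡r : ∀ i j → InD (toℕ i) (toℕ j) → rank w i j ≡ r (toℕ i) (toℕ j)
  rank≡r i j (i<n , _ , j<wi , i<w⁻¹j) = begin
      rank w i j
        ≡⟨ length-filter-tabulate _ id (λ k → 𝟙 ((k <? suc i′) ×-dec (ww k ≤? j′))) (λ k → 𝟙-iff _ _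
             (λ (x , y) → s≤s x , subst (_≤ j′) (sym (extend-toℕ w k)) y)
             (λ (x , y) → ≤-pred x , subst (_≤ j′) (extend-toℕ w k) y)) ⟩
      ∑ n (λ k → 𝟙 ((k <? suc i′) ×-dec (ww k ≤? j′)))  ≡⟨ ∑-restrict (λ k → ww k ≤? j′) i<n ⟩
      ∑ i′ (λ k → 𝟙 (ww k ≤? j′)) + 𝟙 (ww i′ ≤? j′)
        ≡⟨ cong (∑ i′ (λ k → 𝟙 (ww k ≤? j′)) +_) (𝟙-no _ (λ wi≤j → <-irrefl refl (<-≤-trans j<wi wi≤j))) ⟩
      ∑ i′ (λ k → 𝟙 (ww k ≤? j′)) + 0  ≡⟨ +-identityʳ _ ⟩
      ∑ i′ (λ k → 𝟙 (ww k ≤? j′))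
        ≡⟨ ∑-cong i′ (λ k k<i → 𝟙-iff _ _
             (λ wk≤j → ≤∧≢⇒< wk≤j (λ wk≡j → <-irrefl refl (<-trans k<i
                (subst (i′ <_) (trans (cong (ℕPerm.w⁻¹ (asℕPerm w)) (sym wk≡j)) (ℕPerm.w⁻¹∘w (asℕPerm w) k)) i<w⁻¹j))))
             <⇒≤) ⟩
      r i′ j′ ∎
    where
      open ≡-Reasoning
      i′ j′ : ℕ
      i′ = toℕ i
      j′ = toℕ j
      ww : ℕ → ℕ
      ww = extend w

  topMap-image : ∀ {i j} → (i , j) ∈ diagram w → topMap w (i , j) ≡ (topRow (toℕ i) (toℕ j) , toℕ j)
  topMap-image {i} {j} ij∈D = cong (_, toℕ j) (begin
      toℕ i ∸ rank w i j                       ≡⟨ cong (toℕ i ∸_) (rank≡r i j (diagram⇒InD ij∈D)) ⟩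
      toℕ i ∸ r (toℕ i) (toℕ j)                ≡⟨ cong (_∸ r (toℕ i) (toℕ j)) (sym (r+topRow (toℕ i) (toℕ j))) ⟩
      r (toℕ i) (toℕ j) + topRow (toℕ i) (toℕ j) ∸ r (toℕ i) (toℕ j)  ≡⟨ m+n∸m≡n (r (toℕ i) (toℕ j)) _ ⟩
      topRow (toℕ i) (toℕ j) ∎)
    where open ≡-Reasoning

  botMap-image : ∀ {i j} → (i , j) ∈ diagram w → botMap w (i , j) ≡ (toℕ i , botCol (toℕ i) (toℕ j))
  botMap-image {i} {j} ij∈D = cong (toℕ i ,_) (begin
      toℕ j ∸ rank w i j
        ≡⟨ cong (toℕ j ∸_) (trans (rank≡r i j ij) (r≡r′ _ _ (InD⇒a≤n ij) (InD⇒b≤n ij))) ⟩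
      toℕ j ∸ r′ (toℕ i) (toℕ j)               ≡⟨ cong (_∸ r′ (toℕ i) (toℕ j)) (sym (r′+botCol (toℕ i) (toℕ j))) ⟩
      r′ (toℕ i) (toℕ j) + botCol (toℕ i) (toℕ j) ∸ r′ (toℕ i) (toℕ j)  ≡⟨ m+n∸m≡n (r′ (toℕ i) (toℕ j)) _ ⟩
      botCol (toℕ i) (toℕ j) ∎)
    where
      open ≡-Reasoning
      ij : InD (toℕ i) (toℕ j)
      ij = diagram⇒InD ij∈D

  botLabel-botMap : ∀ {i j} → (i , j) ∈ diagram w → botLabel w (botMap w (i , j)) ≡ just (toℕ i , toℕ j)
  botLabel-botMap {i} {j} ij∈D = cong (Maybe.map (λ d → (toℕ (proj₁ d) , toℕ (proj₂ d))))
      (head-filter-unique (λ d → botMap w d ≟c botMap w (i , j)) (diagram w) (i , j) ij∈D refl unique)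
    where
      unique : ∀ y → y ∈ diagram w → botMap w y ≡ botMap w (i , j) → y ≡ (i , j)
      unique (i₂ , j₂) ij₂∈D e with toℕ-injective (cong proj₁ e)
      ... | refl = cong (i ,_) (toℕ-injective (level-sameRow ij₂ ij (begin
          diag (toℕ i) (toℕ j₂)           ≡⟨ diag-botCol _ _ (InD⇒a≤n ij₂) (InD⇒b≤n ij₂) ⟩
          toℕ i + botCol (toℕ i) (toℕ j₂) ≡⟨ cong (λ c → toℕ i + proj₂ c)
                                               (trans (sym (botMap-image ij₂∈D)) (trans e (botMap-image ij∈D))) ⟩
          toℕ i + botCol (toℕ i) (toℕ j)  ≡⟨ sym (diag-botCol _ _ (InD⇒a≤n ij) (InD⇒b≤n ij)) ⟩
          diag (toℕ i) (toℕ j) ∎)))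
        where
          open ≡-Reasoning
          ij : InD (toℕ i) (toℕ j)
          ij = diagram⇒InD ij∈D
          ij₂ : InD (toℕ i) (toℕ j₂)
          ij₂ = diagram⇒InD ij₂∈D

  plusesAbove-bottomPD : ∀ s a → plusesAbove (bottomPD w) s a ≡ onDiagAbove InB? s a
  plusesAbove-bottomPD = onDiagAbove-cong (isPlus (bottomPD w)) InB?
    (Equivalence.to (bottomPD-iff w _ _)) (Equivalence.from (bottomPD-iff w _ _))

  plusesAbove-topPD : ∀ s a → plusesAbove (topPD w) s a ≡ onDiagAbove InT? s a
  plusesAbove-topPD = onDiagAbove-cong (isPlus (topPD w)) InT?
    (Equivalence.to (bottomPD-iff (flip w) _ _)) (Equivalence.from (bottomPD-iff (flip w) _ _))

  botMap-plus : ∀ {i j} → InD i j → bottomPD w (i , botCol i j) ≡ true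
  botMap-plus {i} {j} ij = Equivalence.from (bottomPD-iff w i (botCol i j)) (proj₁ ij ,
    𝟙-pos (botCol i j <? lehmer i) (subst (1 ≤_) (sym (lehmer-row i (botCol i j) (proj₁ ij)))
      (≤-trans (≤-reflexive (sym (𝟙-yes (InD? i j ×-dec (botCol i j ≟ botCol i j)) (ij , refl))))
               (∑-term n _ j (proj₁ (proj₂ ij))))))

  topMap-plus : ∀ {i j} → InD i j → topPD w (topRow i j , j) ≡ true
  topMap-plus {i} {j} (i<n , j<n , j<wi , i<w⁻¹j) = Equivalence.from (bottomPD-iff (flip w) j (topRow i j)) (j<n ,
    𝟙-pos (topRow i j <? Inv.lehmer j) (subst (1 ≤_) (sym (Inv.lehmer-row j (topRow i j) j<n))
      (≤-trans (≤-reflexive (sym (𝟙-yes (Inv.InD? j i ×-dec (topRow i j ≟ topRow i j)) ((j<n , i<n , i<w⁻¹j , j<wi) , refl))))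
               (∑-term n _ i i<n))))

  source-is-botMap : ∀ {I : Set} {L₀ L : Labeling I} {P : PipeDream} → (∀ c → P c ≡ topPD w c) →
                     ∀ {i j} → (i , j) ∈ diagram w → (d : Descends (bottomPD w) L₀ P L (topRow (toℕ i) (toℕ j)) (toℕ j)) →
                     (Descends.srcRow d , Descends.srcCol d) ≡ botMap w (i , j)
  source-is-botMap {P = P} P≡T {i} {j} ij∈D d = trans (cong₂ _,_ a′≡i b′≡botCol) (sym (botMap-image ij∈D))
    where
      open Descends d renaming (srcRow to a′; srcCol to b′)
      B : PipeDream
      B = bottomPD w
      ij : InD (toℕ i) (toℕ j)
      ij = diagram⇒InD ij∈D
      s : ℕ
      s = diag (toℕ i) (toℕ j)
      s≡ : s ≡ toℕ i + botCol (toℕ i) (toℕ j)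
      s≡ = diag-botCol _ _ (InD⇒a≤n ij) (InD⇒b≤n ij)
      same-count : plusesAbove B s a′ ≡ plusesAbove B s (toℕ i)
      same-count = begin
          plusesAbove B s a′                          ≡⟨ sameRank ⟩
          plusesAbove P s (topRow (toℕ i) (toℕ j))    ≡⟨ onDiagAbove-cong (isPlus P) (isPlus (topPD w))
                                                           (λ e → trans (sym (P≡T _)) e) (λ e → trans (P≡T _) e) s t ⟩
          plusesAbove (topPD w) s (topRow (toℕ i) (toℕ j))  ≡⟨ plusesAbove-topPD s t ⟩
          onDiagAbove InT? s (topRow (toℕ i) (toℕ j)) ≡⟨ sym (pluses-above-agree ij) ⟩
          onDiagAbove InB? s (toℕ i)                  ≡⟨ sym (plusesAbove-bottomPD s (toℕ i)) ⟩
          plusesAbove B s (toℕ i) ∎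
        where
          open ≡-Reasoning
          t : ℕ
          t = topRow (toℕ i) (toℕ j)
      a′≡i : a′ ≡ toℕ i
      a′≡i = plusesAbove-injective B s
        (subst (λ t → plusAt B t a′ ≡ 1) sameDiag (plusOnDiag B srcPlus))
        (subst (λ t → plusAt B t (toℕ i) ≡ 1) (sym s≡) (plusOnDiag B (botMap-plus ij)))
        same-count
      b′≡botCol : b′ ≡ botCol (toℕ i) (toℕ j)
      b′≡botCol = +-cancelˡ-≡ (toℕ i) _ _ (trans (cong (_+ b′) (sym a′≡i)) (trans sameDiag s≡))

lemma3p5 : (n : ℕ) (w : Permutation′ n) (P : PipeDream)
           (path : Star SimpleLadder (bottomPD w) P) →
           (∀ c → P c ≡ topPD w c) →
           ∀ (i j : Fin n) → (i , j) ∈ diagram w →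
           inherit path (botLabel w) (topMap w (i , j)) ≡ just (toℕ i , toℕ j)
lemma3p5 n w P path P≡T i j ij∈D = begin
    inherit path (botLabel w) (topMap w (i , j))  ≡⟨ cong (inherit path (botLabel w)) (topMap-image ij∈D) ⟩
    inherit path (botLabel w) (t , toℕ j)         ≡⟨ Descends.sameLabel src ⟩
    botLabel w (Descends.srcRow src , Descends.srcCol src)
                                                  ≡⟨ cong (botLabel w) (source-is-botMap P≡T ij∈D src) ⟩
    botLabel w (botMap w (i , j))                 ≡⟨ botLabel-botMap ij∈D ⟩
    just (toℕ i , toℕ j) ∎
  where
    open ≡-Reasoning
    open ForPermutation w
    open PermStatistics (asℕPerm w) using (topRow)
    t : ℕ
    t = topRow (toℕ i) (toℕ j)
    -- the top image of (i , j) is a plus of P, so it descends from a plus of B_w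
    src : Descends (bottomPD w) (botLabel w) P (inherit path (botLabel w)) t (toℕ j)
    src = inherits-along path (inherits-refl (bottomPD w) (botLabel w)) t (toℕ j)
            (trans (P≡T (t , toℕ j)) (topMap-plus (diagram⇒InD ij∈D)))
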